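{- Let $G$ be a simple graph with degree function $d$, and let $M$ be a maximal matching in $G$. Let $V_M$ be the set of vertices covered by $M$ and $U_M=V(G)\setminus V_M$. Then for every subset $U\subseteq U_M$, $$\sum_{v\in V_M}\min\{d(v)-1,\,|U|\}\ge\sum_{u\in U}d(u).$$
   Context: A matching is a set of pairwise disjoint edges; it is maximal if it is not a proper subset of another matching. A vertex is covered by $M$ if some edge of $M$ is incident to it. -}

module Defs where

open import Data.Nat using (ℕ; _∸_; _⊓_; _+_)
open import Data.Bool using (Bool; true; false; if_then_else_)
open import Data.Fin using (Fin)
open import Data.Fin.Subset using (Subset; _∈_; _∉_; ∣_∣; _⊆_)
open import Data.Fin.Subset.Properties using (_∈?_)
open import Data.List using (List; map; filter; length)
open import Data.Nat.ListAction using (sum)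
open import Data.Bool.ListAction using (any)
open import Data.List.Base using (allFin)
open import Relation.Binary.PropositionalEquality using (_≡_)
open import Relation.Nullary using (¬_)
open import Data.Bool.Properties using (_≟_)

record SimpleGraph (n : ℕ) : Set where
  field
    adj     : Fin n → Fin n → Bool
    sym     : ∀ u v → adj u v ≡ adj v u
    irrefl  : ∀ v → adj v v ≡ false

open SimpleGraph public

degree : ∀ {n} → SimpleGraph n → Fin n → ℕ
degree {n} G v = length (filter (λ w → adj G v w ≟ true) (allFin n))

-- An edge set of G, given as a symmetric Bool relation (M u v ≡ true iff uv ∈ M).
EdgeSet : ℕ → Set
EdgeSet n = Fin n → Fin n → Bool

_⊆E_ : ∀ {n} → EdgeSet n → EdgeSet n → Set
M ⊆E M' = ∀ u v → M u v ≡ true → M' u v ≡ true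

record IsMatching {n} (G : SimpleGraph n) (M : EdgeSet n) : Set where
  field
    symM     : ∀ u v → M u v ≡ M v u
    edges    : ∀ u v → M u v ≡ true → adj G u v ≡ true
    disjoint : ∀ u v w → M u v ≡ true → M u w ≡ true → v ≡ w

record IsMaximalMatching {n} (G : SimpleGraph n) (M : EdgeSet n) : Set where
  field
    matching : IsMatching G M
    maximal  : ∀ M' → IsMatching G M' → M ⊆E M' → M' ⊆E M

covered : ∀ {n} → EdgeSet n → Fin n → Bool
covered {n} M v = any (M v) (allFin n)

coveredVertices : ∀ {n} → EdgeSet n → List (Fin n)
coveredVertices {n} M = filter (λ v → covered M v ≟ true) (allFin n)

sumOver : ∀ {n} → Subset n → (Fin n → ℕ) → ℕ
sumOver {n} U f = sum (map f (filter (λ u → u ∈? U) (allFin n)))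

sumCovered : ∀ {n} → EdgeSet n → (Fin n → ℕ) → ℕ
sumCovered M f = sum (map f (coveredVertices M))

UncoveredSubset : ∀ {n} → EdgeSet n → Subset n → Set
UncoveredSubset M U = ∀ u → u ∈ U → covered M u ≡ false

-- By maximality of M no edge joins two uncovered vertices, so every edge at a
-- vertex of U ends in V_M; double counting these edges gives
-- Σ_{u ∈ U} d(u) = Σ_{v ∈ V_M} |N(v) ∩ U|. Each term on the right is at most |U|,
-- and at most d(v) − 1 because the M-partner of v is a neighbour of v outside U.

module Submission where

open import Defs hiding (sym)
open import Data.Nat using (ℕ; _≤_; _∸_; _⊓_)
open import Data.Fin.Subset using (Subset; ∣_∣)

open import Data.Bool using (Bool; true; false; if_then_else_; _∨_)
open import Data.Bool.Properties using (T-≡; ¬-not; ∨-zeroʳ) renaming (_≟_ to _≟B_)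
open import Data.Empty using (⊥-elim)
open import Data.Fin using (Fin; zero; suc; _≟_)
open import Data.Fin.Subset using (inside; outside; _∉_)
open import Data.Fin.Subset.Properties using (_∈?_)
open import Data.List using (List; []; _∷_; map; filter; length; tabulate; allFin)
open import Data.List.Membership.Propositional.Properties using (∈-allFin)
open import Data.List.Properties using (map-tabulate)
import Data.List.Relation.Unary.Any as Any
open import Data.List.Relation.Unary.Any.Properties using (any⁺; any⁻)
import Data.Nat.ListAction as List
open import Data.Nat using (zero; suc; _+_; _<_; z≤n; s≤s)
open import Data.Nat.Properties
  using (+-0-commutativeMonoid; +-mono-≤; +-mono-<-≤; +-mono-≤-<; ≤-trans; ≤-reflexive; ⊓-glb;
         module ≤-Reasoning)
open import Data.Product using (∃; _×_; _,_)
import Data.Product as Product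
import Data.Vec as Vec
open import Data.Sum using (_⊎_; inj₁; inj₂)
open import Function using (_∘_; mk⇔; Equivalence)
open import Relation.Nullary using (Dec; yes; no; does)
open import Relation.Nullary.Decidable using (_×-dec_; _⊎-dec_; does-⇔; dec-true; dec-false)
open import Relation.Unary using (Pred; Decidable)
open import Relation.Binary.PropositionalEquality

open import Algebra.Properties.CommutativeMonoid.Sum +-0-commutativeMonoid
  using (sum-syntax; ∑-comm; sum-cong-≗; sum-replicate-zero)

sum-map-filter : ∀ {a p} {A : Set a} {P : Pred A p} (P? : Decidable P) (f : A → ℕ) (xs : List A) →
  List.sum (map f (filter P? xs)) ≡ List.sum (map (λ x → if does (P? x) then f x else 0) xs)
sum-map-filter P? f [] = refl
sum-map-filter P? f (x ∷ xs) with does (P? x)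
... | true  = cong (f x +_) (sum-map-filter P? f xs)
... | false = sum-map-filter P? f xs

length-filter : ∀ {a p} {A : Set a} {P : Pred A p} (P? : Decidable P) (xs : List A) →
  length (filter P? xs) ≡ List.sum (map (λ x → if does (P? x) then 1 else 0) xs)
length-filter P? [] = refl
length-filter P? (x ∷ xs) with does (P? x)
... | true  = cong suc (length-filter P? xs)
... | false = length-filter P? xs

sum-tabulate : ∀ {n} (f : Fin n → ℕ) → List.sum (tabulate f) ≡ ∑[ i < n ] f i
sum-tabulate {zero}  f = refl
sum-tabulate {suc n} f = cong (f zero +_) (sum-tabulate (f ∘ suc))

sum-map-allFin : ∀ {n} (f : Fin n → ℕ) → List.sum (map f (allFin n)) ≡ ∑[ i < n ] f i
sum-map-allFin f = trans (cong List.sum (map-tabulate (λ i → i) f)) (sum-tabulate f)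

∑-mono-≤ : ∀ {n} {f g : Fin n → ℕ} → (∀ i → f i ≤ g i) → ∑[ i < n ] f i ≤ ∑[ i < n ] g i
∑-mono-≤ {zero}  f≤g = z≤n
∑-mono-≤ {suc n} f≤g = +-mono-≤ (f≤g zero) (∑-mono-≤ (f≤g ∘ suc))

∑-mono-< : ∀ {n} {f g : Fin n → ℕ} → (∀ i → f i ≤ g i) → ∀ j → f j < g j →
  ∑[ i < n ] f i < ∑[ i < n ] g i
∑-mono-< f≤g zero    fj<gj = +-mono-<-≤ fj<gj (∑-mono-≤ (f≤g ∘ suc))
∑-mono-< f≤g (suc j) fj<gj = +-mono-≤-< (f≤g zero) (∑-mono-< (f≤g ∘ suc) j fj<gj)

∑-zero : ∀ {n} {f : Fin n → ℕ} → (∀ i → f i ≡ 0) → ∑[ i < n ] f i ≡ 0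
∑-zero {n} f≡0 = trans (sum-cong-≗ f≡0) (sum-replicate-zero n)

∑-∈-indicator : ∀ {n} (U : Subset n) → ∑[ i < n ] (if does (i ∈? U) then 1 else 0) ≡ ∣ U ∣
∑-∈-indicator Vec.[]            = refl
∑-∈-indicator (inside  Vec.∷ U) = cong suc (∑-∈-indicator U)
∑-∈-indicator (outside Vec.∷ U) = ∑-∈-indicator U

witness : ∀ {p} {P : Set p} (P? : Dec P) → does P? ≡ true → P
witness (yes p) _  = p
witness (no _)  ()

∨-true⁻ : ∀ {a b} → a ∨ b ≡ true → a ≡ true ⊎ b ≡ true
∨-true⁻ {true}  _ = inj₁ refl
∨-true⁻ {false} e = inj₂ e

module _ {n} (M : EdgeSet n) where

  covered⁺ : ∀ {v w} → M v w ≡ true → covered M v ≡ true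
  covered⁺ {v} {w} e = Equivalence.to T-≡
    (any⁺ (M v) (Any.map (λ { refl → Equivalence.from T-≡ e }) (∈-allFin w)))

  covered⁻ : ∀ {v} → covered M v ≡ true → ∃ λ w → M v w ≡ true
  covered⁻ {v} e = Product.map₂ (Equivalence.to T-≡)
    (Any.satisfied (any⁻ (M v) (allFin n) (Equivalence.from T-≡ e)))

  uncovered-not-incident : ∀ {v w} → covered M v ≡ false → M v w ≢ true
  uncovered-not-incident v-free e with () ← trans (sym (covered⁺ e)) v-free

module _ {n} (u w : Fin n) where

  Joins : Fin n → Fin n → Set
  Joins x y = (x ≡ u × y ≡ w) ⊎ (x ≡ w × y ≡ u)

  joins? : ∀ x y → Dec (Joins x y)
  joins? x y = (x ≟ u ×-dec y ≟ w) ⊎-dec (x ≟ w ×-dec y ≟ u)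

  joins-sym : ∀ {x y} → Joins x y → Joins y x
  joins-sym (inj₁ (x≡u , y≡w)) = inj₂ (y≡w , x≡u)
  joins-sym (inj₂ (x≡w , y≡u)) = inj₁ (y≡u , x≡w)

  joins-functional : u ≢ w → ∀ {x y z} → Joins x y → Joins x z → y ≡ z
  joins-functional u≢w (inj₁ (_ , y≡w))   (inj₁ (_ , z≡w))   = trans y≡w (sym z≡w)
  joins-functional u≢w (inj₂ (_ , y≡u))   (inj₂ (_ , z≡u))   = trans y≡u (sym z≡u)
  joins-functional u≢w (inj₁ (x≡u , _))   (inj₂ (x≡w , _))   = ⊥-elim (u≢w (trans (sym x≡u) x≡w))
  joins-functional u≢w (inj₂ (x≡w , _))   (inj₁ (x≡u , _))   = ⊥-elim (u≢w (trans (sym x≡u) x≡w))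

insertEdge : ∀ {n} → EdgeSet n → Fin n → Fin n → EdgeSet n
insertEdge M u w x y = M x y ∨ does (joins? u w x y)

module _ {n} {G : SimpleGraph n} {M : EdgeSet n} (M-matching : IsMatching G M)
         {u w : Fin n} (u-free : covered M u ≡ false) (w-free : covered M w ≡ false)
         (uw : adj G u w ≡ true) where

  open IsMatching M-matching

  private
    u≢w : u ≢ w
    u≢w refl with () ← trans (sym uw) (irrefl G u)

    endpoint-free : ∀ {x y z} → Joins u w x y → M x z ≢ true
    endpoint-free (inj₁ (refl , _)) = uncovered-not-incident M u-free
    endpoint-free (inj₂ (refl , _)) = uncovered-not-incident M w-free

  insertEdge-isMatching : IsMatching G (insertEdge M u w)
  insertEdge-isMatching = record
    { symM     = λ x y → cong₂ _∨_ (symM x y)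
                   (does-⇔ (mk⇔ (joins-sym u w) (joins-sym u w)) (joins? u w x y) (joins? u w y x))
    ; edges    = edges′
    ; disjoint = disjoint′
    }
    where
    edges′ : ∀ x y → insertEdge M u w x y ≡ true → adj G x y ≡ true
    edges′ x y e with ∨-true⁻ e
    ... | inj₁ xy∈M = edges x y xy∈M
    ... | inj₂ xy=uw with witness (joins? u w x y) xy=uw
    ...   | inj₁ (refl , refl) = uw
    ...   | inj₂ (refl , refl) = trans (SimpleGraph.sym G w u) uw

    disjoint′ : ∀ x y z → insertEdge M u w x y ≡ true → insertEdge M u w x z ≡ true → y ≡ z
    disjoint′ x y z e e′ with ∨-true⁻ e | ∨-true⁻ e′
    ... | inj₁ xy∈M  | inj₁ xz∈M  = disjoint x y z xy∈M xz∈M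
    ... | inj₁ xy∈M  | inj₂ xz=uw = ⊥-elim (endpoint-free (witness (joins? u w x z) xz=uw) xy∈M)
    ... | inj₂ xy=uw | inj₁ xz∈M  = ⊥-elim (endpoint-free (witness (joins? u w x y) xy=uw) xz∈M)
    ... | inj₂ xy=uw | inj₂ xz=uw =
      joins-functional u w u≢w (witness (joins? u w x y) xy=uw) (witness (joins? u w x z) xz=uw)

uncovered-nonadjacent : ∀ {n} {G : SimpleGraph n} {M : EdgeSet n} → IsMaximalMatching G M →
  ∀ {u w} → covered M u ≡ false → covered M w ≡ false → adj G u w ≡ false
uncovered-nonadjacent {G = G} {M} M-maximal {u} {w} u-free w-free with adj G u w in uw
... | false = refl
... | true  = ⊥-elim (uncovered-not-incident M u-free uw∈M)
  where
  open IsMaximalMatching M-maximal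
  uw∈M : M u w ≡ true
  uw∈M = maximal (insertEdge M u w) (insertEdge-isMatching matching u-free w-free uw)
    (λ x y xy∈M → cong (_∨ does (joins? u w x y)) xy∈M) u w
    (trans (cong (M u w ∨_) (dec-true (joins? u w u w) (inj₁ (refl , refl)))) (∨-zeroʳ (M u w)))

m<n⇒m≤n∸1 : ∀ {m n} → m < n → m ≤ n ∸ 1
m<n⇒m≤n∸1 (s≤s m≤n) = m≤n

𝟙 : Bool → ℕ
𝟙 b = if does (b ≟B true) then 1 else 0

𝟙≤1 : ∀ b → 𝟙 b ≤ 1
𝟙≤1 true  = s≤s z≤n
𝟙≤1 false = z≤n

module _ {n} (G : SimpleGraph n) where

  degree≡∑ : ∀ v → degree G v ≡ ∑[ w < n ] 𝟙 (adj G v w)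
  degree≡∑ v = trans (length-filter (λ w → adj G v w ≟B true) (allFin n)) (sum-map-allFin (𝟙 ∘ adj G v))

  neighboursIn : Subset n → Fin n → ℕ
  neighboursIn U w = ∑[ u < n ] (if does (u ∈? U) then 𝟙 (adj G u w) else 0)

  sumOver-degree≡∑neighboursIn : ∀ U → sumOver U (degree G) ≡ ∑[ w < n ] neighboursIn U w
  sumOver-degree≡∑neighboursIn U = begin
    sumOver U (degree G)
      ≡⟨ sum-map-filter (_∈? U) (degree G) (allFin n) ⟩
    List.sum (map (λ u → if does (u ∈? U) then degree G u else 0) (allFin n))
      ≡⟨ sum-map-allFin (λ u → if does (u ∈? U) then degree G u else 0) ⟩
    ∑[ u < n ] (if does (u ∈? U) then degree G u else 0)
      ≡⟨ sum-cong-≗ row ⟩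
    ∑[ u < n ] ∑[ w < n ] (if does (u ∈? U) then 𝟙 (adj G u w) else 0)
      ≡⟨ ∑-comm (λ u w → if does (u ∈? U) then 𝟙 (adj G u w) else 0) ⟩
    ∑[ w < n ] neighboursIn U w ∎
    where
    open ≡-Reasoning
    row : ∀ u → (if does (u ∈? U) then degree G u else 0)
              ≡ ∑[ w < n ] (if does (u ∈? U) then 𝟙 (adj G u w) else 0)
    row u with does (u ∈? U)
    ... | true  = degree≡∑ u
    ... | false = sym (sum-replicate-zero n)

  neighboursIn≤∣U∣ : ∀ U w → neighboursIn U w ≤ ∣ U ∣
  neighboursIn≤∣U∣ U w = ≤-trans (∑-mono-≤ atMostOne) (≤-reflexive (∑-∈-indicator U))
    where
    atMostOne : ∀ u → (if does (u ∈? U) then 𝟙 (adj G u w) else 0) ≤ (if does (u ∈? U) then 1 else 0)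
    atMostOne u with does (u ∈? U)
    ... | true  = 𝟙≤1 (adj G u w)
    ... | false = z≤n

  neighboursIn<degree : ∀ U {w p} → adj G w p ≡ true → p ∉ U → neighboursIn U w < degree G w
  neighboursIn<degree U {w} {p} wp p∉U =
    subst (neighboursIn U w <_) (sym (degree≡∑ w)) (∑-mono-< neighbour p p-outside)
    where
    neighbour : ∀ u → (if does (u ∈? U) then 𝟙 (adj G u w) else 0) ≤ 𝟙 (adj G w u)
    neighbour u with does (u ∈? U)
    ... | true  = ≤-reflexive (cong 𝟙 (SimpleGraph.sym G u w))
    ... | false = z≤n
    p-outside : (if does (p ∈? U) then 𝟙 (adj G p w) else 0) < 𝟙 (adj G w p)
    p-outside rewrite dec-false (p ∈? U) p∉U | wp = s≤s z≤n

module _ {n} {G : SimpleGraph n} {M : EdgeSet n} {U : Subset n} (U-free : UncoveredSubset M U) where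

  neighboursIn-uncovered : IsMaximalMatching G M → ∀ {w} → covered M w ≡ false →
    neighboursIn G U w ≡ 0
  neighboursIn-uncovered M-maximal {w} w-free = ∑-zero noNeighbour
    where
    noNeighbour : ∀ u → (if does (u ∈? U) then 𝟙 (adj G u w) else 0) ≡ 0
    noNeighbour u with u ∈? U
    ... | yes u∈U = cong 𝟙 (uncovered-nonadjacent M-maximal (U-free u u∈U) w-free)
    ... | no  _   = refl

  neighboursIn-covered : IsMatching G M → ∀ {w} → covered M w ≡ true →
    neighboursIn G U w ≤ (degree G w ∸ 1) ⊓ ∣ U ∣
  neighboursIn-covered M-matching {w} w-covered with covered⁻ M w-covered
  ... | p , wp∈M = ⊓-glb (m<n⇒m≤n∸1 (neighboursIn<degree G U (edges w p wp∈M) p∉U))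
                         (neighboursIn≤∣U∣ G U w)
    where
    open IsMatching M-matching
    p∉U : p ∉ U
    p∉U p∈U = uncovered-not-incident M (U-free p p∈U) (trans (symM p w) wp∈M)

sumCovered≡∑ : ∀ {n} (M : EdgeSet n) (f : Fin n → ℕ) →
  sumCovered M f ≡ ∑[ v < n ] (if does (covered M v ≟B true) then f v else 0)
sumCovered≡∑ {n} M f = trans (sum-map-filter _ f (allFin n))
  (sum-map-allFin (λ v → if does (covered M v ≟B true) then f v else 0))

lemma5p1 : ∀ {n} (G : SimpleGraph n) (M : EdgeSet n) → IsMaximalMatching G M →
    (U : Subset n) → UncoveredSubset M U →
    sumOver U (degree G) ≤ sumCovered M (λ v → (degree G v ∸ 1) ⊓ ∣ U ∣)
lemma5p1 {n} G M M-maximal U U-free = begin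
  sumOver U (degree G)                                        ≡⟨ sumOver-degree≡∑neighboursIn G U ⟩
  ∑[ w < n ] neighboursIn G U w                               ≤⟨ ∑-mono-≤ bound ⟩
  ∑[ w < n ] (if does (covered M w ≟B true) then cap w else 0) ≡⟨ sumCovered≡∑ M cap ⟨
  sumCovered M cap                                            ∎
  where
  open ≤-Reasoning
  cap : Fin n → ℕ
  cap v = (degree G v ∸ 1) ⊓ ∣ U ∣
  bound : ∀ w → neighboursIn G U w ≤ (if does (covered M w ≟B true) then cap w else 0)
  bound w with covered M w ≟B true
  ... | yes w-covered = neighboursIn-covered U-free (IsMaximalMatching.matching M-maximal) w-covered
  ... | no  w-free    = ≤-reflexive (neighboursIn-uncovered U-free M-maximal (¬-not w-free))
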